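{- Let $\pi$ be a permutation of length $k$ and let $\pi'$ be the permutation matrix obtained by rotating the matrix of $\pi$ by 90 degrees counterclockwise. Then for $n$ a power of $4k^2$, $\mathsf{ex}(n,\pi)=O\big(nk^3(f(4k^2,\pi)+f(4k^2,\pi'))\big)$.
   Context: A permutation $\pi$ of length $k$ is identified with its $k\times k$ permutation matrix. A 0/1 matrix $M$ contains a pattern matrix $P$ if $P$ can be obtained from $M$ by deleting rows, columns, and turning 1-entries into 0; otherwise $M$ avoids $P$. $\mathsf{ex}(n,P)$ is the maximum number of 1-entries in an $n\times n$ 0/1 matrix avoiding $P$. For a permutation $\pi$ and integer $c\ge 2|\pi|$, $f(c,\pi)$ is the maximum number $r$ such that there exists a 0/1 matrix with $r$ rows and $c$ columns in which every row has at least $2|\pi|$ ones and which avoids $\pi$. -}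

module Defs where

open import Data.Nat using (ℕ; zero; suc; _+_; _*_; _≤_)
open import Data.Fin using (Fin; zero; suc; _<_; opposite; _≟_)
open import Data.Bool using (Bool; true; false)
open import Data.Product using (Σ; _×_; ∃; ∃-syntax)
open import Relation.Nullary using (¬_)
open import Relation.Nullary.Decidable using (⌊_⌋)
open import Relation.Binary.PropositionalEquality using (_≡_)
open import Data.Fin.Permutation using (Permutation′; _⟨$⟩ʳ_)

Matrix : ℕ → ℕ → Set
Matrix r c = Fin r → Fin c → Bool

sumFin : ∀ {n} → (Fin n → ℕ) → ℕ
sumFin {zero}  f = 0
sumFin {suc n} f = f zero + sumFin (λ i → f (suc i))

b2n : Bool → ℕ
b2n true  = 1
b2n false = 0

rowOnes : ∀ {c} → (Fin c → Bool) → ℕ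
rowOnes row = sumFin (λ j → b2n (row j))

ones : ∀ {r c} → Matrix r c → ℕ
ones M = sumFin (λ i → rowOnes (M i))

StrictlyIncreasing : ∀ {a b} → (Fin a → Fin b) → Set
StrictlyIncreasing g = ∀ i j → i < j → g i < g j

-- M contains P: P is obtained from M by deleting rows and columns
-- and turning some 1-entries into 0.
Contains : ∀ {r c a b} → Matrix r c → Matrix a b → Set
Contains {r} {c} {a} {b} M P =
  ∃[ ρ ] ∃[ κ ] (StrictlyIncreasing {a} {r} ρ × StrictlyIncreasing {b} {c} κ ×
    (∀ i j → P i j ≡ true → M (ρ i) (κ j) ≡ true))

Avoids : ∀ {r c a b} → Matrix r c → Matrix a b → Set
Avoids M P = ¬ Contains M P

permMatrix : ∀ {k} → Permutation′ k → Matrix k k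
permMatrix π i j = ⌊ (π ⟨$⟩ʳ i) ≟ j ⌋

-- rotation by 90 degrees counterclockwise: the last column becomes the top row
rotateCCW : ∀ {k} → Matrix k k → Matrix k k
rotateCCW A i j = A j (opposite i)

IsEx : ∀ {a b} → ℕ → Matrix a b → ℕ → Set
IsEx n P e =
  (Σ (Matrix n n) λ M → Avoids M P × ones M ≡ e) ×
  (∀ (M : Matrix n n) → Avoids M P → ones M ≤ e)

RichRows : ∀ {r c} → ℕ → Matrix r c → Set
RichRows {r} k M = ∀ (i : Fin r) → 2 * k ≤ rowOnes (M i)

IsF : ∀ {k} → ℕ → Matrix k k → ℕ → Set
IsF {k} c P r =
  (Σ (Matrix r c) λ M → RichRows k M × Avoids M P) ×
  (∀ r′ (M : Matrix r′ c) → RichRows k M → Avoids M P → r′ ≤ r)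

{-# OPTIONS --safe #-}

-- Cut a (ts)×(ts) matrix M avoiding π into t×t blocks of size s = 4k², and call a block wide
-- (tall) if it has at least 2k nonzero columns (rows). The column supports of the wide blocks of
-- one block column form a matrix with rich rows avoiding π, so there are at most f(s,π) of them;
-- likewise the row supports of the tall blocks of one block row avoid π', so there are at most
-- f(s,π') of those. Every other block has at most (2k-1)² ones, and the t×t matrix marking the
-- nonzero blocks again avoids π. Hence ex(ts,π) ≤ (2k-1)² ex(t,π) + s² t (f(s,π) + f(s,π')),
-- and since (2k-1)² < s this recursion gives ex(s^m,π) ≤ 8 s^m k³ (f(s,π) + f(s,π')).

module Submission where

open import Defs
open import Level using (Level)
open import Data.Bool as Bool using (Bool; true; false)
open import Data.Bool.Properties using (¬-not)
open import Data.Empty using (⊥-elim)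
open import Data.Fin as Fin using (Fin; zero; suc; toℕ; combine; opposite; _↑ˡ_; _↑ʳ_; _≟_)
open import Data.Fin.Properties
  using (toℕ-combine; combine-monoˡ-<; opposite-prop; opposite-involutive; toℕ<n; any?)
open import Data.Fin.Permutation using (Permutation′; _⟨$⟩ʳ_; _⟨$⟩ˡ_; inverseˡ; inverseʳ)
open import Data.Nat using (ℕ; zero; suc; _+_; _*_; _^_; _≤_; _≤?_; pred; z≤n; s≤s)
open import Data.Nat.Properties hiding (_≟_)
open import Data.Nat.Tactic.RingSolver using (solve-∀)
open import Data.Product using (_,_; ∃-syntax; proj₁; proj₂)
open import Function using (_∘_)
open import Relation.Nullary using (Dec; yes; no; does; ¬_)
open import Relation.Nullary.Decidable using (dec-true; isYes≗does)
open import Relation.Unary using (Pred; Decidable)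
open import Relation.Binary.PropositionalEquality
open import Algebra.Properties.CommutativeSemigroup +-commutativeSemigroup using (interchange)

private variable
  ℓ : Level
  k m n p q r c : ℕ

does-true⇒ : ∀ {A : Set ℓ} (a? : Dec A) → does a? ≡ true → A
does-true⇒ (yes a) _ = a

does-false⇒ : ∀ {A : Set ℓ} (a? : Dec A) → does a? ≡ false → ¬ A
does-false⇒ (no ¬a) _ = ¬a

sumFin-cong : {f g : Fin n → ℕ} → (∀ i → f i ≡ g i) → sumFin f ≡ sumFin g
sumFin-cong {zero}  f≗g = refl
sumFin-cong {suc n} f≗g = cong₂ _+_ (f≗g zero) (sumFin-cong (f≗g ∘ suc))

sumFin-mono : {f g : Fin n → ℕ} → (∀ i → f i ≤ g i) → sumFin f ≤ sumFin g
sumFin-mono {zero}  f≤g = z≤n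
sumFin-mono {suc n} f≤g = +-mono-≤ (f≤g zero) (sumFin-mono (f≤g ∘ suc))

sumFin-const : ∀ n x → sumFin {n} (λ _ → x) ≡ n * x
sumFin-const zero    x = refl
sumFin-const (suc n) x = cong (x +_) (sumFin-const n x)

sumFin-≤-const : ∀ {x} {f : Fin n → ℕ} → (∀ i → f i ≤ x) → sumFin f ≤ n * x
sumFin-≤-const {n} {x} f≤x = ≤-trans (sumFin-mono f≤x) (≤-reflexive (sumFin-const n x))

sumFin-+ : (f g : Fin n → ℕ) → sumFin (λ i → f i + g i) ≡ sumFin f + sumFin g
sumFin-+ {zero}  f g = refl
sumFin-+ {suc n} f g =
  trans (cong (f zero + g zero +_) (sumFin-+ (f ∘ suc) (g ∘ suc)))
        (interchange (f zero) (g zero) (sumFin (f ∘ suc)) (sumFin (g ∘ suc)))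

sumFin-*ˡ : ∀ x (f : Fin n → ℕ) → sumFin (λ i → x * f i) ≡ x * sumFin f
sumFin-*ˡ {zero}  x f = sym (*-zeroʳ x)
sumFin-*ˡ {suc n} x f =
  trans (cong (x * f zero +_) (sumFin-*ˡ x (f ∘ suc))) (sym (*-distribˡ-+ x (f zero) _))

sumFin-*ʳ : ∀ x (f : Fin n → ℕ) → sumFin (λ i → f i * x) ≡ sumFin f * x
sumFin-*ʳ x f = trans (sumFin-cong (λ i → *-comm (f i) x)) (trans (sumFin-*ˡ x f) (*-comm x _))

sumFin-linear : ∀ a b c (f g h : Fin n → ℕ) →
  sumFin (λ i → a * f i + b * g i + c * h i) ≡ a * sumFin f + b * sumFin g + c * sumFin h
sumFin-linear a b c f g h = begin
  sumFin (λ i → a * f i + b * g i + c * h i)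
    ≡⟨ trans (sumFin-+ (λ i → a * f i + b * g i) (λ i → c * h i))
             (cong (_+ sumFin (λ i → c * h i)) (sumFin-+ (λ i → a * f i) (λ i → b * g i))) ⟩
  sumFin (λ i → a * f i) + sumFin (λ i → b * g i) + sumFin (λ i → c * h i)
    ≡⟨ cong₂ _+_ (cong₂ _+_ (sumFin-*ˡ a f) (sumFin-*ˡ b g)) (sumFin-*ˡ c h) ⟩
  a * sumFin f + b * sumFin g + c * sumFin h ∎
  where open ≡-Reasoning

sumFin-comm : (f : Fin m → Fin n → ℕ) →
  sumFin (λ i → sumFin (λ j → f i j)) ≡ sumFin (λ j → sumFin (λ i → f i j))
sumFin-comm {zero}  {n} f = sym (trans (sumFin-const n 0) (*-zeroʳ n))
sumFin-comm {suc m} {n} f =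
  trans (cong (sumFin (f zero) +_) (sumFin-comm (f ∘ suc))) (sym (sumFin-+ (f zero) _))

sumFin-↑ : ∀ m n (f : Fin (m + n) → ℕ) → sumFin f ≡ sumFin (λ i → f (i ↑ˡ n)) + sumFin (λ j → f (m ↑ʳ j))
sumFin-↑ zero    n f = refl
sumFin-↑ (suc m) n f = trans (cong (f zero +_) (sumFin-↑ m n (f ∘ suc))) (sym (+-assoc (f zero) _ _))

sumFin-combine : ∀ m n (f : Fin (m * n) → ℕ) →
  sumFin f ≡ sumFin (λ i → sumFin (λ j → f (combine {m} {n} i j)))
sumFin-combine zero    n f = refl
sumFin-combine (suc m) n f =
  trans (sumFin-↑ n (m * n) f) (cong (sumFin (λ j → f (j ↑ˡ (m * n))) +_) (sumFin-combine m n (f ∘ (n ↑ʳ_))))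

b2n≤1 : ∀ b → b2n b ≤ 1
b2n≤1 true  = s≤s z≤n
b2n≤1 false = z≤n

rowOnes≤length : (row : Fin c → Bool) → rowOnes row ≤ c
rowOnes≤length {c} row = ≤-trans (sumFin-≤-const (b2n≤1 ∘ row)) (≤-reflexive (*-identityʳ c))

ones≤area : (X : Matrix r c) → ones X ≤ r * c
ones≤area X = sumFin-≤-const (rowOnes≤length ∘ X)

Nonzero : (Fin n → Bool) → Set
Nonzero row = ∃[ j ] row j ≡ true

nonzero? : (row : Fin n → Bool) → Dec (Nonzero row)
nonzero? row = any? (λ j → row j Bool.≟ true)

rowOnes-zero : (row : Fin n → Bool) → ¬ Nonzero row → rowOnes row ≡ 0
rowOnes-zero {n} row ¬nonzero =
  trans (sumFin-cong (λ j → cong b2n (¬-not (λ e → ¬nonzero (j , e)))))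
        (trans (sumFin-const n 0) (*-zeroʳ n))

rowSupport : Matrix r c → Fin r → Bool
rowSupport X a = does (nonzero? (X a))

colSupport : Matrix r c → Fin c → Bool
colSupport X b = does (nonzero? (λ a → X a b))

height width : Matrix r c → ℕ
height X = rowOnes (rowSupport X)
width  X = rowOnes (colSupport X)

entry≤supports : (X : Matrix r c) → ∀ a b → b2n (X a b) ≤ b2n (rowSupport X a) * b2n (colSupport X b)
entry≤supports X a b with X a b in e
... | false = z≤n
... | true rewrite dec-true (nonzero? (X a)) (b , e) | dec-true (nonzero? (λ a′ → X a′ b)) (a , e) =
  s≤s z≤n

ones≤height*width : (X : Matrix r c) → ones X ≤ height X * width X
ones≤height*width X = begin
  ones X
    ≤⟨ sumFin-mono (λ a → sumFin-mono (entry≤supports X a)) ⟩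
  sumFin (λ a → sumFin (λ b → b2n (rowSupport X a) * b2n (colSupport X b)))
    ≡⟨ sumFin-cong (λ a → sumFin-*ˡ (b2n (rowSupport X a)) (b2n ∘ colSupport X)) ⟩
  sumFin (λ a → b2n (rowSupport X a) * width X)
    ≡⟨ sumFin-*ʳ (width X) (b2n ∘ rowSupport X) ⟩
  height X * width X ∎
  where open ≤-Reasoning

nonzeroRow-entry : (X : Matrix r c) → Nonzero (rowSupport X) → ∃[ a ] ∃[ b ] X a b ≡ true
nonzeroRow-entry X (a , e) = a , does-true⇒ (nonzero? (X a)) e

Wide Tall : ℕ → Matrix r c → Set
Wide k X = 2 * k ≤ width X
Tall k X = 2 * k ≤ height X

wide? : ∀ k (X : Matrix r c) → Dec (Wide k X)
wide? k X = 2 * k ≤? width X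

tall? : ∀ k (X : Matrix r c) → Dec (Tall k X)
tall? k X = 2 * k ≤? height X

ones≤blockCost : ∀ k (X : Matrix r c) →
  ones X ≤ pred (2 * k) * pred (2 * k) * b2n (does (nonzero? (rowSupport X)))
           + r * c * b2n (does (wide? k X)) + r * c * b2n (does (tall? k X))
ones≤blockCost {r} {c} k X
  with does (wide? k X) in wide | does (tall? k X) in tall | does (nonzero? (rowSupport X)) in nonzero
... | true  | tall | nonzero =
  ≤-trans (ones≤area X) (≤-trans (≤-reflexive (sym (*-identityʳ (r * c))))
    (≤-trans (m≤n+m (r * c * 1) (pred (2 * k) * pred (2 * k) * b2n nonzero)) (m≤m+n _ (r * c * b2n tall))))
... | false | true | _ =
  ≤-trans (ones≤area X) (≤-trans (≤-reflexive (sym (*-identityʳ (r * c)))) (m≤n+m (r * c * 1) _))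
... | false | false | false =
  ≤-trans (ones≤height*width X)
    (≤-trans (≤-reflexive (cong (_* width X) (rowOnes-zero (rowSupport X) (does-false⇒ (nonzero? _) nonzero))))
             z≤n)
... | false | false | true =
  ≤-trans (ones≤height*width X)
    (≤-trans (*-mono-≤ (below (does-false⇒ (tall? k X) tall)) (below (does-false⇒ (wide? k X) wide)))
      (≤-trans (≤-reflexive (sym (*-identityʳ _))) (≤-trans (m≤m+n _ _) (m≤m+n _ _))))
  where
  below : ∀ {x} → ¬ 2 * k ≤ x → x ≤ pred (2 * k)
  below = suc[m]≤n⇒m≤pred[n] ∘ ≰⇒>

count : {P : Pred (Fin n) ℓ} → Decidable P → ℕ
count P? = sumFin (λ i → b2n (does (P? i)))

record Enumeration {P : Pred (Fin n) ℓ} (P? : Decidable P) : Set ℓ where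
  field
    size             : ℕ
    index            : Fin size → Fin n
    index-increasing : StrictlyIncreasing index
    index-satisfies  : ∀ i → P (index i)
    size≡count       : size ≡ count P?

enumerate : {P : Pred (Fin n) ℓ} (P? : Decidable P) → Enumeration P?
enumerate {zero} P? = record
  { size = 0 ; index = λ () ; index-increasing = λ () ; index-satisfies = λ () ; size≡count = refl }
enumerate {suc n} {P = P} P? with P? zero in P?0
... | no _  = record
  { size             = E.size
  ; index            = suc ∘ E.index
  ; index-increasing = λ i j i<j → s≤s (E.index-increasing i j i<j)
  ; index-satisfies  = E.index-satisfies
  ; size≡count       = trans E.size≡count (cong (λ d → b2n (does d) + count (P? ∘ suc)) (sym P?0))
  }
  where module E = Enumeration (enumerate (P? ∘ suc))
... | yes p = record
  { size             = suc E.size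
  ; index            = index
  ; index-increasing = increasing
  ; index-satisfies  = satisfies
  ; size≡count       = trans (cong suc E.size≡count) (cong (λ d → b2n (does d) + count (P? ∘ suc)) (sym P?0))
  }
  where
  module E = Enumeration (enumerate (P? ∘ suc))
  index : Fin (suc E.size) → Fin (suc n)
  index zero    = zero
  index (suc i) = suc (E.index i)
  increasing : StrictlyIncreasing index
  increasing zero    (suc j) _         = s≤s z≤n
  increasing (suc i) (suc j) (s≤s i<j) = s≤s (E.index-increasing i j i<j)
  satisfies : ∀ i → P (index i)
  satisfies zero    = p
  satisfies (suc i) = E.index-satisfies i

opposite-reverses-< : {i j : Fin n} → i Fin.< j → opposite j Fin.< opposite i
opposite-reverses-< {n} {i} {j} i<j rewrite opposite-prop i | opposite-prop j = ∸-monoʳ-< (s≤s i<j) (toℕ<n j)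

combine-monoʳ-< : (i : Fin m) {a b : Fin n} → a Fin.< b → combine i a Fin.< combine i b
combine-monoʳ-< {m} {n} i {a} {b} a<b rewrite toℕ-combine i a | toℕ-combine i b = +-monoʳ-< (n * toℕ i) a<b

module _ (π : Permutation′ k) where

  permMatrix-diagonal : ∀ i → permMatrix π i (π ⟨$⟩ʳ i) ≡ true
  permMatrix-diagonal i = trans (isYes≗does _) (dec-true (π ⟨$⟩ʳ i ≟ π ⟨$⟩ʳ i) refl)

  rotateCCW-permMatrix-diagonal : ∀ j → rotateCCW (permMatrix π) (opposite (π ⟨$⟩ʳ j)) j ≡ true
  rotateCCW-permMatrix-diagonal j =
    subst (λ l → permMatrix π j l ≡ true) (sym (opposite-involutive _)) (permMatrix-diagonal j)

  contains-permMatrix : (M : Matrix r c) (x : Fin k → Fin r) (y : Fin k → Fin c) →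
    StrictlyIncreasing x → (∀ i j → π ⟨$⟩ʳ i Fin.< π ⟨$⟩ʳ j → y i Fin.< y j) →
    (∀ i → M (x i) (y i) ≡ true) → Contains M (permMatrix π)
  contains-permMatrix M x y x-increasing y-increasing M[x,y] =
    x , y ∘ (π ⟨$⟩ˡ_) , x-increasing , yπ⁻¹-increasing , entries
    where
    yπ⁻¹-increasing : StrictlyIncreasing (y ∘ (π ⟨$⟩ˡ_))
    yπ⁻¹-increasing i j i<j = y-increasing _ _ (subst₂ Fin._<_ (sym (inverseʳ π)) (sym (inverseʳ π)) i<j)
    entries : ∀ i j → permMatrix π i j ≡ true → M (x i) (y (π ⟨$⟩ˡ j)) ≡ true
    entries i j e with does-true⇒ (π ⟨$⟩ʳ i ≟ j) (trans (sym (isYes≗does _)) e)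
    ... | refl = subst (λ l → M (x i) (y l) ≡ true) (sym (inverseˡ π)) (M[x,y] i)

module Blocks {m n p q : ℕ} (M : Matrix (m * p) (n * q)) where

  block : Fin m → Fin n → Matrix p q
  block I J a b = M (combine I a) (combine J b)

  ones-blocks : ones M ≡ sumFin (λ I → sumFin (λ J → ones (block I J)))
  ones-blocks =
    trans (sumFin-combine m p (rowOnes ∘ M))
      (sumFin-cong (λ I → trans (sumFin-cong (λ a → sumFin-combine n q (b2n ∘ M (combine I a))))
                                (sumFin-comm (λ a J → rowOnes (block I J a)))))

  contraction : Matrix m n
  contraction I J = does (nonzero? (rowSupport (block I J)))

  contraction-avoids : (π : Permutation′ k) → Avoids M (permMatrix π) → Avoids contraction (permMatrix π)
  contraction-avoids {k} π M-avoids (ρ , κ , ρ-increasing , κ-increasing , embeds) =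
    M-avoids (contains-permMatrix π M x y x-increasing y-increasing (proj₂ ∘ proj₂ ∘ entry))
    where
    entry : ∀ i → ∃[ a ] ∃[ b ] block (ρ i) (κ (π ⟨$⟩ʳ i)) a b ≡ true
    entry i = nonzeroRow-entry _ (does-true⇒ (nonzero? _) (embeds i _ (permMatrix-diagonal π i)))
    x : Fin k → Fin (m * p)
    x i = combine (ρ i) (proj₁ (entry i))
    y : Fin k → Fin (n * q)
    y i = combine (κ (π ⟨$⟩ʳ i)) (proj₁ (proj₂ (entry i)))
    x-increasing : StrictlyIncreasing x
    x-increasing i j i<j = combine-monoˡ-< _ _ (ρ-increasing i j i<j)
    y-increasing : ∀ i j → π ⟨$⟩ʳ i Fin.< π ⟨$⟩ʳ j → y i Fin.< y j
    y-increasing i j πi<πj = combine-monoˡ-< _ _ (κ-increasing _ _ πi<πj)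

module _ (π : Permutation′ k) {m n s : ℕ} (M : Matrix (m * s) (n * s))
         (M-avoids : Avoids M (permMatrix π)) where

  open Blocks {m} {n} {s} {s} M

  -- The column supports of the wide blocks of block column J form a matrix with rich rows,
  -- and a copy of π in it lifts to one in M.
  wideBlocks≤f : ∀ {r} → IsF s (permMatrix π) r → ∀ J → count (λ I → wide? k (block I J)) ≤ r
  wideBlocks≤f {r} (_ , maximal) J = subst (_≤ r) E.size≡count (maximal E.size W E.index-satisfies W-avoids)
    where
    module E = Enumeration (enumerate (λ I → wide? k (block I J)))
    W : Matrix E.size s
    W i = colSupport (block (E.index i) J)
    W-avoids : Avoids W (permMatrix π)
    W-avoids (ρ , κ , ρ-increasing , κ-increasing , embeds) =
      M-avoids (contains-permMatrix π M x y x-increasing y-increasing (proj₂ ∘ entry))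
      where
      entry : ∀ i → ∃[ a ] block (E.index (ρ i)) J a (κ (π ⟨$⟩ʳ i)) ≡ true
      entry i = does-true⇒ (nonzero? _) (embeds i _ (permMatrix-diagonal π i))
      x : Fin k → Fin (m * s)
      x i = combine (E.index (ρ i)) (proj₁ (entry i))
      y : Fin k → Fin (n * s)
      y i = combine J (κ (π ⟨$⟩ʳ i))
      x-increasing : StrictlyIncreasing x
      x-increasing i j i<j = combine-monoˡ-< _ _ (E.index-increasing _ _ (ρ-increasing i j i<j))
      y-increasing : ∀ i j → π ⟨$⟩ʳ i Fin.< π ⟨$⟩ʳ j → y i Fin.< y j
      y-increasing i j πi<πj = combine-monoʳ-< J (κ-increasing _ _ πi<πj)

  -- Listing the tall blocks of block row I from right to left, their row supports form the
  -- compressed block row rotated counterclockwise, so a copy of π' in it is a copy of π in M.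
  tallBlocks≤f : ∀ {r} → IsF s (rotateCCW (permMatrix π)) r → ∀ I → count (λ J → tall? k (block I J)) ≤ r
  tallBlocks≤f {r} (_ , maximal) I =
    subst (_≤ r) E.size≡count (maximal E.size T (E.index-satisfies ∘ opposite) T-avoids)
    where
    module E = Enumeration (enumerate (λ J → tall? k (block I J)))
    T : Matrix E.size s
    T i = rowSupport (block I (E.index (opposite i)))
    T-avoids : Avoids T (rotateCCW (permMatrix π))
    T-avoids (ρ , κ , ρ-increasing , κ-increasing , embeds) =
      M-avoids (contains-permMatrix π M x y x-increasing y-increasing (proj₂ ∘ entry))
      where
      column : Fin k → Fin n
      column j = E.index (opposite (ρ (opposite (π ⟨$⟩ʳ j))))
      entry : ∀ j → ∃[ b ] block I (column j) (κ j) b ≡ true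
      entry j = does-true⇒ (nonzero? _) (embeds _ j (rotateCCW-permMatrix-diagonal π j))
      x : Fin k → Fin (m * s)
      x j = combine I (κ j)
      y : Fin k → Fin (n * s)
      y j = combine (column j) (proj₁ (entry j))
      x-increasing : StrictlyIncreasing x
      x-increasing i j i<j = combine-monoʳ-< I (κ-increasing i j i<j)
      y-increasing : ∀ i j → π ⟨$⟩ʳ i Fin.< π ⟨$⟩ʳ j → y i Fin.< y j
      y-increasing i j πi<πj = combine-monoˡ-< _ _ (E.index-increasing _ _
        (opposite-reverses-< (ρ-increasing _ _ (opposite-reverses-< πi<πj))))

ExBound : ∀ {a b} → ℕ → Matrix a b → ℕ → Set
ExBound n P e = ∀ (M : Matrix n n) → Avoids M P → ones M ≤ e

module _ (π : Permutation′ k) {s r₁ r₂ : ℕ}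
  (f₁ : IsF s (permMatrix π) r₁) (f₂ : IsF s (rotateCCW (permMatrix π)) r₂) where

  exBound-blowup : ∀ {t e} → ExBound t (permMatrix π) e →
    ExBound (t * s) (permMatrix π) (pred (2 * k) * pred (2 * k) * e + s * s * (t * r₁) + s * s * (t * r₂))
  exBound-blowup {t} {e} exBound M M-avoids = begin
    ones M
      ≡⟨ ones-blocks ⟩
    sumFin (λ I → sumFin (λ J → ones (block I J)))
      ≤⟨ sumFin-mono (λ I → sumFin-mono (λ J → ones≤blockCost k (block I J))) ⟩
    sumFin (λ I → sumFin (λ J → d * d * occupied I J + s * s * wide I J + s * s * tall I J))
      ≡⟨ trans (sumFin-cong (λ I → sumFin-linear (d * d) (s * s) (s * s) (occupied I) (wide I) (tall I)))
               (sumFin-linear (d * d) (s * s) (s * s) (sumFin ∘ occupied) (sumFin ∘ wide) (sumFin ∘ tall)) ⟩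
    d * d * ones contraction + s * s * sumFin (sumFin ∘ wide) + s * s * sumFin (sumFin ∘ tall)
      ≤⟨ +-mono-≤ (+-mono-≤ (*-monoʳ-≤ (d * d) (exBound contraction (contraction-avoids π M-avoids)))
                            (*-monoʳ-≤ (s * s) wideTotal))
                  (*-monoʳ-≤ (s * s) (sumFin-≤-const (tallBlocks≤f π {t} {t} M M-avoids f₂))) ⟩
    d * d * e + s * s * (t * r₁) + s * s * (t * r₂) ∎
    where
    open ≤-Reasoning
    open Blocks {t} {t} {s} {s} M
    d : ℕ
    d = pred (2 * k)
    occupied wide tall : Fin t → Fin t → ℕ
    occupied I J = b2n (contraction I J)
    wide I J     = b2n (does (wide? k (block I J)))
    tall I J     = b2n (does (tall? k (block I J)))
    wideTotal : sumFin (sumFin ∘ wide) ≤ t * r₁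
    wideTotal = ≤-trans (≤-reflexive (sumFin-comm wide)) (sumFin-≤-const (wideBlocks≤f π {t} {t} M M-avoids f₁))

IsF-positive : ∀ {k c r} (P : Matrix (suc (suc k)) (suc (suc k))) → 2 * suc (suc k) ≤ c → IsF c P r → 1 ≤ r
IsF-positive {k} {c} P 2k≤c (_ , maximal) = maximal 1 full full-rich full-avoids
  where
  full : Matrix 1 c
  full _ _ = true
  full-rich : RichRows (suc (suc k)) full
  full-rich zero = ≤-trans 2k≤c (≤-reflexive (sym (trans (sumFin-const c 1) (*-identityʳ c))))
  full-avoids : Avoids full P
  full-avoids (ρ , _ , ρ-increasing , _) with ρ zero | ρ (suc zero) | ρ-increasing zero (suc zero) (s≤s z≤n)
  ... | zero | zero | ()

contains-permMatrix-1 : (π : Permutation′ 1) {M : Matrix r c} (a : Fin r) (b : Fin c) →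
  M a b ≡ true → Contains M (permMatrix π)
contains-permMatrix-1 π {M} a b e = contains-permMatrix π M (λ _ → a) (λ _ → b)
  (λ { zero zero () }) (λ { zero zero πi<πi → ⊥-elim (<-irrefl refl πi<πi) }) (λ { zero → e })

-- For k = 1 the bound can be 0, so M must be empty; for k ≥ 2 already f(s,π) ≥ 1.
exBound-base : ∀ {k₀ r₁} r₂ (π : Permutation′ (suc k₀)) → IsF (4 * suc k₀ * suc k₀) (permMatrix π) r₁ →
  ExBound 1 (permMatrix π) (8 * 1 * suc k₀ ^ 3 * (r₁ + r₂))
exBound-base {zero} r₂ π _ M M-avoids with M zero zero in e
... | false = z≤n
... | true  = ⊥-elim (M-avoids (contains-permMatrix-1 π {M} zero zero e))
exBound-base {suc k₁} {r₁} r₂ π f₁ M _ =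
  ≤-trans (ones≤area M)
    (≤-trans (IsF-positive (permMatrix π) 2k≤s f₁)
      (≤-trans (m≤m+n r₁ r₂) (m≤n*m (r₁ + r₂) (8 * 1 * suc (suc k₁) ^ 3))))
  where
  2k≤s : 2 * suc (suc k₁) ≤ 4 * suc (suc k₁) * suc (suc k₁)
  2k≤s = ≤-trans (*-monoˡ-≤ (suc (suc k₁)) {2} {4} (s≤s (s≤s z≤n))) (m≤m*n (4 * suc (suc k₁)) (suc (suc k₁)))

pred-2*suc : ∀ n → pred (2 * suc n) ≡ 2 * n + 1
pred-2*suc n = trans (+-suc n (n + 0)) (+-comm 1 (2 * n))

exBound-recursion-closes : ∀ k₀ t r₁ r₂ → let k = suc k₀ ; s = 4 * k * k ; d = pred (2 * k) in
  d * d * (8 * t * k ^ 3 * (r₁ + r₂)) + s * s * (t * r₁) + s * s * (t * r₂) ≤ 8 * (s * t) * k ^ 3 * (r₁ + r₂)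
exBound-recursion-closes k₀ t r₁ r₂ = begin
  d * d * e + s * s * (t * r₁) + s * s * (t * r₂)
    ≡⟨ cong (λ x → x * x * e + s * s * (t * r₁) + s * s * (t * r₂)) (pred-2*suc k₀) ⟩
  d′ * d′ * e + s * s * (t * r₁) + s * s * (t * r₂)
    ≤⟨ m≤m+n _ (8 * K ^ 3 * d′ * t * (r₁ + r₂)) ⟩
  d′ * d′ * e + s * s * (t * r₁) + s * s * (t * r₂) + 8 * K ^ 3 * d′ * t * (r₁ + r₂)
    ≡⟨ identity k₀ t r₁ r₂ ⟨
  8 * (s * t) * K ^ 3 * (r₁ + r₂) ∎
  where
  open ≤-Reasoning
  K s d d′ e : ℕ
  K  = suc k₀
  s  = 4 * K * K
  d  = pred (2 * K)
  d′ = 2 * k₀ + 1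
  e  = 8 * t * K ^ 3 * (r₁ + r₂)
  -- k³ is k ^ 3 unfolded: the ring solver does not accept _^_ with a literal exponent.
  identity : ∀ k₀ t r₁ r₂ → let k = suc k₀ ; s = 4 * k * k ; d = 2 * k₀ + 1 ; k³ = k * (k * (k * 1)) in
    8 * (s * t) * k³ * (r₁ + r₂)
      ≡ d * d * (8 * t * k³ * (r₁ + r₂)) + s * s * (t * r₁) + s * s * (t * r₂) + 8 * k³ * d * t * (r₁ + r₂)
  identity = solve-∀

module _ {k₀ r₁ r₂ : ℕ} (π : Permutation′ (suc k₀))
  (f₁ : IsF (4 * suc k₀ * suc k₀) (permMatrix π) r₁)
  (f₂ : IsF (4 * suc k₀ * suc k₀) (rotateCCW (permMatrix π)) r₂) where

  private
    K s : ℕ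
    K = suc k₀
    s = 4 * K * K

  exBound-power : ∀ m → ExBound (s ^ m) (permMatrix π) (8 * s ^ m * K ^ 3 * (r₁ + r₂))
  exBound-power zero = exBound-base r₂ π f₁
  exBound-power (suc m) M M-avoids =
    ≤-trans (blowup M M-avoids) (exBound-recursion-closes k₀ (s ^ m) r₁ r₂)
    where
    blowupBound : ℕ
    blowupBound = pred (2 * K) * pred (2 * K) * (8 * s ^ m * K ^ 3 * (r₁ + r₂))
                  + s * s * (s ^ m * r₁) + s * s * (s ^ m * r₂)
    blowup : ExBound (s ^ suc m) (permMatrix π) blowupBound
    blowup = subst (λ n → ExBound n (permMatrix π) blowupBound) (*-comm (s ^ m) s)
                   (exBound-blowup π f₁ f₂ (exBound-power m))

mainTheorem6 : ∃[ C ] (∀ (k : ℕ) → 1 ≤ k → (π : Permutation′ k) →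
    ∀ (m : ℕ) → ∀ (e r₁ r₂ : ℕ) →
    IsEx ((4 * k * k) ^ m) (permMatrix π) e →
    IsF (4 * k * k) (permMatrix π) r₁ →
    IsF (4 * k * k) (rotateCCW (permMatrix π)) r₂ →
    e ≤ C * ((4 * k * k) ^ m) * (k ^ 3) * (r₁ + r₂))
mainTheorem6 = 8 , λ { (suc k₀) (s≤s z≤n) π m e r₁ r₂ ((M , M-avoids , ones≡e) , _) f₁ f₂ →
  subst (_≤ _) ones≡e (exBound-power π f₁ f₂ m M M-avoids) }
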